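{- Let $G$ be a finite bipartite multigraph with bipartition $\{A,B\}$ and maximum degree at most $3$. Suppose that every edge $e$ of $G$ is assigned a bijection (distortion) $r_e$ of the set $\{0,1,2,3\}$. Then there exists a function $f: E(G)\to\{0,1,2,3\}$ such that (i) for every vertex $a\in A$ and any two distinct edges $e,g$ incident with $a$, $f(e)\neq f(g)$; and (ii) for every vertex $b\in B$ and any two distinct edges $e,g$ incident with $b$, $r_e(f(e))\neq r_g(f(g))$.
   Context: A function $f$ satisfying (i) and (ii) is called a proper distortion-colouring of $E(G)$ with the 4 colours $0,1,2,3$ with respect to the distortions $r_e$. Multigraphs may have parallel edges; each parallel edge carries its own distortion. -}

module Defs where

open import Data.Nat using (ℕ; _≤_)
open import Data.Fin using (Fin)
open import Data.Fin.Properties using (_≟_)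
open import Data.List using (length; filter; allFin)
open import Data.Fin.Permutation using (Permutation′; _⟨$⟩ʳ_)
open import Relation.Binary.PropositionalEquality using (_≡_)
open import Relation.Nullary using (¬_)

-- Parallel edges are allowed (endpoints need not be injective).
record BipartiteMultigraph : Set where
  field
    nA nB m : ℕ
    endA : Fin m → Fin nA
    endB : Fin m → Fin nB

open BipartiteMultigraph public

Edge : BipartiteMultigraph → Set
Edge G = Fin (m G)

degA : (G : BipartiteMultigraph) → Fin (nA G) → ℕ
degA G a = length (filter (λ e → endA G e ≟ a) (allFin (m G)))

degB : (G : BipartiteMultigraph) → Fin (nB G) → ℕ
degB G b = length (filter (λ e → endB G e ≟ b) (allFin (m G)))

MaxDegreeAtMost : ℕ → BipartiteMultigraph → Set
MaxDegreeAtMost k G = (∀ a → degA G a ≤ k) × (∀ b → degB G b ≤ k)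
  where open import Data.Product using (_×_)

Distortion : Set
Distortion = Permutation′ 4

IsProperDistortionColouring : (G : BipartiteMultigraph) → (Edge G → Distortion) →
  (Edge G → Fin 4) → Set
IsProperDistortionColouring G r f =
  (∀ (e g : Edge G) → ¬ e ≡ g → endA G e ≡ endA G g → ¬ f e ≡ f g) ×
  (∀ (e g : Edge G) → ¬ e ≡ g → endB G e ≡ endB G g →
     ¬ (r e ⟨$⟩ʳ f e) ≡ (r g ⟨$⟩ʳ f g))
  where open import Data.Product using (_×_)

module Submission where

-- Think of the edges as the vertices of the line graph: for an edge x, a neighbour y at the
-- A-end forbids the colour f y, and a neighbour y at the B-end forbids r x⁻¹ (r y (f y)).
-- Every edge has at most four neighbours and there are four colours, so we argue as for
-- Brooks' theorem, by induction on the number of edges.  If some edge e = ab has at most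
-- three neighbours, colour the rest and then e.  Otherwise a and b have degree 3.  If every
-- edge at a ends at b, these three parallel edges form a component and are coloured directly.
-- Otherwise take u at a not ending at b and w at b not ending at a.  Delete the edges at a and
-- b other than u, move u to the A-end of w with distortion r_u ∘ r_e⁻¹ ∘ r_w, and colour this
-- smaller multigraph.  Moving the colour of u to w, and giving u the colour that w then forbids
-- for e, makes u and w forbid the same colour of e.  The other edges at a and b are coloured
-- greedily, since each still sees the uncoloured e, and e comes last.

open import Defs
open import Level using (0ℓ)
open import Data.Nat using (ℕ; zero; suc; _+_; _≤_; _<_; z≤n; s≤s; s≤s⁻¹; _≤?_)
open import Data.Nat.Properties
  using (≤-refl; ≤-reflexive; ≤-trans; <-≤-trans; ≤-<-trans; ≤-antisym; <⇒≱; ≮⇒≥; n≮0;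
         +-suc; +-mono-≤; +-monoʳ-≤; n≤1+n; m≤n⇒m≤1+n; m<n⇒m<1+n)
open import Data.Fin using (Fin; zero)
open import Data.Fin.Properties using (_≟_; ¬∀⟶∃¬; pigeonhole) renaming (any? to anyᶠ?; <-irrefl to <-irreflᶠ)
open import Data.Fin.Permutation using (_⟨$⟩ʳ_; _⟨$⟩ˡ_; inverseˡ; inverseʳ; _∘ₚ_; flip)
open import Data.List using (List; []; _∷_; length; filter; allFin; lookup; map; _++_)
open import Data.List.Properties using (filter-none; length-++; length-map)
open import Data.List.Membership.Propositional using (_∈_; _∉_)
open import Data.List.Membership.Propositional.Properties
  using (∈-allFin; ∈-filter⁺; ∈-filter⁻; ∈-map⁺; ∈-++⁺ˡ; ∈-++⁺ʳ)
open import Data.List.Relation.Unary.All using (All; []; _∷_)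
import Data.List.Relation.Unary.All as All
open import Data.List.Relation.Unary.All.Properties using (all-filter)
open import Data.List.Relation.Unary.AllPairs using ([]; _∷_)
open import Data.List.Relation.Unary.Any using (here; there; index; any?)
open import Data.List.Relation.Unary.Any.Properties using (lookup-index)
open import Data.List.Relation.Unary.Unique.Propositional using (Unique)
open import Data.List.Relation.Unary.Unique.Propositional.Properties using (allFin⁺; filter⁺)
open import Data.Product using (Σ; ∃; ∃₂; _,_; _×_; proj₁; proj₂; map₂)
open import Data.Sum using (_⊎_; inj₁; inj₂)
open import Data.Unit using (tt)
open import Data.Vec.Functional using (updateAt)
open import Data.Vec.Functional.Properties using (updateAt-updates; updateAt-minimal)
open import Function using (_∘_; const)
open import Relation.Binary.PropositionalEquality
  using (_≡_; _≢_; refl; sym; trans; cong; cong₂; subst; subst₂)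
open import Relation.Nullary using (¬_; Dec; yes; no; contradiction)
open import Relation.Nullary.Decidable using (decidable-stable; _⊎-dec_)
open import Relation.Unary using (Pred; Decidable; _⊆_; _∪_; _∩_; ∁; ｛_｝)
open import Relation.Unary.Properties using (U?; _∪?_; _∩?_; ∁?)

module _ {A : Set} {P Q : Pred A 0ℓ} (P? : Decidable P) (Q? : Decidable Q) where

  length-filter-mono : P ⊆ Q → ∀ xs → length (filter P? xs) ≤ length (filter Q? xs)
  length-filter-mono P⊆Q [] = z≤n
  length-filter-mono P⊆Q (x ∷ xs) with P? x | Q? x
  ... | yes _  | yes _  = s≤s (length-filter-mono P⊆Q xs)
  ... | yes px | no ¬qx = contradiction (P⊆Q px) ¬qx
  ... | no _   | yes _  = m≤n⇒m≤1+n (length-filter-mono P⊆Q xs)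
  ... | no _   | no _   = length-filter-mono P⊆Q xs

  length-filter-< : P ⊆ Q → ∀ {x xs} → x ∈ xs → Q x → ¬ P x →
                    length (filter P? xs) < length (filter Q? xs)
  length-filter-< P⊆Q {x} {xs = y ∷ ys} (here refl) qx ¬px with P? x | Q? x
  ... | yes px | _      = contradiction px ¬px
  ... | no _   | no ¬qx = contradiction qx ¬qx
  ... | no _   | yes _  = s≤s (length-filter-mono P⊆Q ys)
  length-filter-< P⊆Q {xs = y ∷ ys} (there x∈ys) qx ¬px with P? y | Q? y
  ... | yes _  | yes _  = s≤s (length-filter-< P⊆Q x∈ys qx ¬px)
  ... | yes py | no ¬qy = contradiction (P⊆Q py) ¬qy
  ... | no _   | yes _  = m<n⇒m<1+n (length-filter-< P⊆Q x∈ys qx ¬px)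
  ... | no _   | no _   = length-filter-< P⊆Q x∈ys qx ¬px

  length-filter-∪ : ∀ xs → length (filter (P? ∪? Q?) xs) ≤ length (filter P? xs) + length (filter Q? xs)
  length-filter-∪ [] = z≤n
  length-filter-∪ (x ∷ xs) with P? x | Q? x
  ... | yes _ | yes _ = s≤s (≤-trans (length-filter-∪ xs) (+-monoʳ-≤ _ (n≤1+n _)))
  ... | yes _ | no _  = s≤s (length-filter-∪ xs)
  ... | no _  | yes _ = ≤-trans (s≤s (length-filter-∪ xs)) (≤-reflexive (sym (+-suc _ _)))
  ... | no _  | no _  = length-filter-∪ xs

length-filter-｛｝ : ∀ {n} (x : Fin n) {xs} → Unique xs → length (filter (x ≟_) xs) ≤ 1
length-filter-｛｝ x {[]} [] = z≤n
length-filter-｛｝ x {y ∷ ys} (y∉ys ∷ unique) with x ≟ y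
... | yes refl = ≤-reflexive (cong (suc ∘ length) (filter-none (x ≟_) {ys} y∉ys))
... | no _     = length-filter-｛｝ x unique

count : ∀ {n} {P : Pred (Fin n) 0ℓ} → Decidable P → ℕ
count {n} P? = length (filter P? (allFin n))

infixl 5 _-_ _-?_

_-_ : ∀ {A : Set} → Pred A 0ℓ → A → Pred A 0ℓ
P - x = P ∩ ∁ ｛ x ｝

_-?_ : ∀ {n} {P : Pred (Fin n) 0ℓ} → Decidable P → (x : Fin n) → Decidable (P - x)
P? -? x = P? ∩? ∁? (x ≟_)

module _ {n} {P Q : Pred (Fin n) 0ℓ} (P? : Decidable P) (Q? : Decidable Q) where

  count-mono : P ⊆ Q → count P? ≤ count Q?
  count-mono P⊆Q = length-filter-mono P? Q? P⊆Q (allFin n)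

  count-< : ∀ {x} → P ⊆ Q → Q x → ¬ P x → count P? < count Q?
  count-< P⊆Q = length-filter-< P? Q? P⊆Q (∈-allFin _)

  count-∪ : count (P? ∪? Q?) ≤ count P? + count Q?
  count-∪ = length-filter-∪ P? Q? (allFin n)

  count-⊇ : P ⊆ Q → count Q? ≤ count P? → Q ⊆ P
  count-⊇ P⊆Q Q≤P {x} qx = decidable-stable (P? x) λ ¬px →
    <⇒≱ (count-< P⊆Q qx ¬px) Q≤P

count-｛｝ : ∀ {n} (x : Fin n) → count (x ≟_) ≤ 1
count-｛｝ {n} x = length-filter-｛｝ x (allFin⁺ n)

count-remove : ∀ {n} {P : Pred (Fin n) 0ℓ} (P? : Decidable P) {x} → P x → count (P? -? x) < count P?
count-remove P? px = count-< (P? -? _) P? (λ (py , _) → py) px (λ (_ , x≢x) → x≢x refl)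

count-remove-member : ∀ {n} {N : Pred (Fin n) 0ℓ} (N? : Decidable N) {e} → N e → count N? < 3 → count (N? -? e) < 2
count-remove-member N? ne N<3 = <-≤-trans (count-remove N? ne) (s≤s⁻¹ N<3)

count-remove-any : ∀ {n} {N : Pred (Fin n) 0ℓ} (N? : Decidable N) {e} → count N? < 3 → count (N? -? e) < 3
count-remove-any N? N<3 = ≤-<-trans (count-mono (N? -? _) N? proj₁) N<3

length<⇒∃∉ : ∀ {n} (xs : List (Fin n)) → length xs < n → ∃ λ c → c ∉ xs
length<⇒∃∉ {n} xs len = ¬∀⟶∃¬ n (_∈ xs) (λ c → any? (c ≟_) xs) not-all
  where
  not-all : ¬ (∀ c → c ∈ xs)
  not-all every with pigeonhole len (index ∘ every)
  ... | i , j , i<j , same = <-irreflᶠ i≡j i<j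
    where
    i≡j : i ≡ j
    i≡j = trans (lookup-index (every i)) (trans (cong (lookup xs) same) (sym (lookup-index (every j))))

sum-bound : ∀ {p q k l} → p < k → q < l → k + l ≤ 5 → p + q ≤ 3
sum-bound {p} {q} p<k q<l k+l≤5 =
  s≤s⁻¹ (s≤s⁻¹ (≤-trans (≤-reflexive (cong suc (sym (+-suc p q)))) (≤-trans (+-mono-≤ p<k q<l) k+l≤5)))

both≡3 : ∀ {x y} → x ≤ 3 → y ≤ 3 → ¬ x + y ≤ 5 → x ≡ 3 × y ≡ 3
both≡3 x≤3 y≤3 x+y≰5 =
  ≤-antisym x≤3 (≮⇒≥ λ x<3 → x+y≰5 (+-mono-≤ (s≤s⁻¹ x<3) y≤3)) ,
  ≤-antisym y≤3 (≮⇒≥ λ y<3 → x+y≰5 (+-mono-≤ x≤3 (s≤s⁻¹ y<3)))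

-- Colouring three pairwise parallel edges

Separated : Distortion → Fin 4 → Distortion → Fin 4 → Set
Separated p c q d = c ≢ d × p ⟨$⟩ʳ c ≢ q ⟨$⟩ʳ d

Separated-sym : ∀ p q {c d} → Separated p c q d → Separated q d p c
Separated-sym p q (c≢d , pc≢qd) = c≢d ∘ sym , pc≢qd ∘ sym

SeparatedTriple : Distortion → Distortion → Distortion → Fin 4 → Fin 4 → Fin 4 → Set
SeparatedTriple p q s c₁ c₂ c₃ = Separated p c₁ q c₂ × Separated p c₁ s c₃ × Separated q c₂ s c₃

⟨$⟩ʳ⇒⟨$⟩ˡ : ∀ (π : Distortion) {c x} → π ⟨$⟩ʳ c ≡ x → π ⟨$⟩ˡ x ≡ c
⟨$⟩ʳ⇒⟨$⟩ˡ π πc≡x = trans (cong (π ⟨$⟩ˡ_) (sym πc≡x)) (inverseˡ π)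

separated-partner : ∀ p q c₁ → ∃ λ c₂ → Separated p c₁ q c₂
separated-partner p q c₁ = map₂ separated (length<⇒∃∉ excluded (s≤s (s≤s (s≤s z≤n))))
  where
  excluded : List (Fin 4)
  excluded = c₁ ∷ (q ⟨$⟩ˡ (p ⟨$⟩ʳ c₁)) ∷ []
  separated : ∀ {c₂} → c₂ ∉ excluded → Separated p c₁ q c₂
  separated c₂∉ = (λ c₁≡c₂ → c₂∉ (here (sym c₁≡c₂))) ,
                  (λ pc₁≡qc₂ → c₂∉ (there (here (sym (⟨$⟩ʳ⇒⟨$⟩ˡ q (sym pc₁≡qc₂))))))

-- If s⁻¹ (p c₁) is c₁ or c₂, the four constraints on c₃ exclude at most three colours.
third-colour : ∀ p q s c₁ c₂ → s ⟨$⟩ˡ (p ⟨$⟩ʳ c₁) ∈ c₁ ∷ c₂ ∷ [] →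
               ∃ λ c₃ → Separated p c₁ s c₃ × Separated q c₂ s c₃
third-colour p q s c₁ c₂ redundant = map₂ separated (length<⇒∃∉ excluded ≤-refl)
  where
  excluded : List (Fin 4)
  excluded = c₁ ∷ c₂ ∷ (s ⟨$⟩ˡ (q ⟨$⟩ʳ c₂)) ∷ []
  separated : ∀ {c₃} → c₃ ∉ excluded → Separated p c₁ s c₃ × Separated q c₂ s c₃
  separated {c₃} c₃∉ = (avoids (here refl) , avoids-image (∈-++⁺ˡ redundant)) ,
                       (avoids (there (here refl)) , avoids-image (there (there (here refl))))
    where
    avoids : ∀ {c} → c ∈ excluded → c ≢ c₃
    avoids c∈ refl = c₃∉ c∈
    avoids-image : ∀ {x} → s ⟨$⟩ˡ x ∈ excluded → x ≢ s ⟨$⟩ʳ c₃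
    avoids-image x∈ x≡sc₃ = c₃∉ (subst (_∈ excluded) (⟨$⟩ʳ⇒⟨$⟩ˡ s (sym x≡sc₃)) x∈)

separate-three-agreeing : ∀ p q s c → s ⟨$⟩ʳ c ≡ p ⟨$⟩ʳ c → ∃ λ c₁ → ∃₂ (SeparatedTriple p q s c₁)
separate-three-agreeing p q s c₁ agree =
  let c₂ , sep₁₂ = separated-partner p q c₁
      c₃ , sep₁₃ , sep₂₃ = third-colour p q s c₁ c₂ (here (⟨$⟩ʳ⇒⟨$⟩ˡ s agree))
  in c₁ , c₂ , c₃ , sep₁₂ , sep₁₃ , sep₂₃

separate-three-disagreeing : ∀ p q s → ¬ ∃ (λ c → s ⟨$⟩ʳ c ≡ p ⟨$⟩ʳ c) → ¬ ∃ (λ c → s ⟨$⟩ʳ c ≡ q ⟨$⟩ʳ c) →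
                             ∃ λ c₁ → ∃₂ (SeparatedTriple p q s c₁)
separate-three-disagreeing p q s ¬agree-p ¬agree-q =
  let c₃ , sep₁₃ , sep₂₃ = third-colour p q s c₁ c₂ (there (here refl))
  in c₁ , c₂ , c₃ , sep₁₂ , sep₁₃ , sep₂₃
  where
  c₁ c₂ : Fin 4
  c₁ = zero
  c₂ = s ⟨$⟩ˡ (p ⟨$⟩ʳ c₁)
  sep₁₂ : Separated p c₁ q c₂
  sep₁₂ = (λ c₁≡c₂ → ¬agree-p (c₁ , trans (cong (s ⟨$⟩ʳ_) c₁≡c₂) (inverseʳ s))) ,
          (λ pc₁≡qc₂ → ¬agree-q (c₂ , trans (inverseʳ s) pc₁≡qc₂))

swap-first : ∀ p q s {c₂ c₁ c₃} → SeparatedTriple q p s c₂ c₁ c₃ → SeparatedTriple p q s c₁ c₂ c₃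
swap-first p q s (sep₂₁ , sep₂₃ , sep₁₃) = Separated-sym q p sep₂₁ , sep₁₃ , sep₂₃

-- Either s agrees with p or with q somewhere, or choosing c₂ = s⁻¹(p c₁) makes the two
-- constraints s c₃ ≢ p c₁ and c₃ ≢ c₂ coincide.
separate-three : ∀ p q s → ∃ λ c₁ → ∃₂ (SeparatedTriple p q s c₁)
separate-three p q s = by-cases (anyᶠ? (λ c → s ⟨$⟩ʳ c ≟ p ⟨$⟩ʳ c)) (anyᶠ? (λ c → s ⟨$⟩ʳ c ≟ q ⟨$⟩ʳ c))
  where
  by-cases : Dec (∃ λ c → s ⟨$⟩ʳ c ≡ p ⟨$⟩ʳ c) → Dec (∃ λ c → s ⟨$⟩ʳ c ≡ q ⟨$⟩ʳ c) →
             ∃ λ c₁ → ∃₂ (SeparatedTriple p q s c₁)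
  by-cases (yes (c , agree)) _ = separate-three-agreeing p q s c agree
  by-cases (no _) (yes (c , agree)) =
    let c₂ , c₁ , c₃ , sep = separate-three-agreeing q p s c agree in c₁ , c₂ , c₃ , swap-first p q s sep
  by-cases (no ¬agree-p) (no ¬agree-q) = separate-three-disagreeing p q s ¬agree-p ¬agree-q

-- Proper colourings of sets of edges

module Degrees (G : BipartiteMultigraph) {act : Pred (Edge G) 0ℓ} (act? : Decidable act) where

  StarA : Fin (nA G) → Pred (Edge G) 0ℓ
  StarA a y = act y × endA G y ≡ a

  StarB : Fin (nB G) → Pred (Edge G) 0ℓ
  StarB b y = act y × endB G y ≡ b

  starA? : ∀ a → Decidable (StarA a)
  starA? a = act? ∩? (λ y → endA G y ≟ a)

  starB? : ∀ b → Decidable (StarB b)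
  starB? b = act? ∩? (λ y → endB G y ≟ b)

  degreeA : Fin (nA G) → ℕ
  degreeA a = count (starA? a)

  degreeB : Fin (nB G) → ℕ
  degreeB b = count (starB? b)

  Subcubic : Set
  Subcubic = (∀ a → degreeA a ≤ 3) × (∀ b → degreeB b ≤ 3)

  NbrA NbrB : Edge G → Pred (Edge G) 0ℓ
  NbrA x = StarA (endA G x) - x
  NbrB x = StarB (endB G x) - x

  nbrA? : ∀ x → Decidable (NbrA x)
  nbrA? x = starA? (endA G x) -? x

  nbrB? : ∀ x → Decidable (NbrB x)
  nbrB? x = starB? (endB G x) -? x

  count-nbrA< : ∀ {x} → act x → count (nbrA? x) < degreeA (endA G x)
  count-nbrA< ax = count-remove (starA? _) (ax , refl)

  count-nbrB< : ∀ {x} → act x → count (nbrB? x) < degreeB (endB G x)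
  count-nbrB< ax = count-remove (starB? _) (ax , refl)

  Touches : Edge G → Pred (Edge G) 0ℓ
  Touches e y = endA G y ≡ endA G e ⊎ endB G y ≡ endB G e

  touches? : ∀ e → Decidable (Touches e)
  touches? e y = (endA G y ≟ endA G e) ⊎-dec (endB G y ≟ endB G e)

module Colouring (G : BipartiteMultigraph) (r : Edge G → Distortion) where

  Compatible : (Edge G → Fin 4) → Edge G → Edge G → Set
  Compatible f x y = (endA G x ≡ endA G y → f x ≢ f y) ×
                     (endB G x ≡ endB G y → r x ⟨$⟩ʳ f x ≢ r y ⟨$⟩ʳ f y)

  Compatible-sym : ∀ {f x y} → Compatible f x y → Compatible f y x
  Compatible-sym (sameA⇒≢ , sameB⇒≢) = (λ eq → sameA⇒≢ (sym eq) ∘ sym) , (λ eq → sameB⇒≢ (sym eq) ∘ sym)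

  ProperOn : Pred (Edge G) 0ℓ → (Edge G → Fin 4) → Set
  ProperOn C f = ∀ {x y} → C x → C y → x ≢ y → Compatible f x y

  ProperOn-mono : ∀ {C D f} → D ⊆ C → ProperOn C f → ProperOn D f
  ProperOn-mono D⊆C proper dx dy = proper (D⊆C dx) (D⊆C dy)

  Admissible : Pred (Edge G) 0ℓ → (Edge G → Fin 4) → Edge G → Fin 4 → Set
  Admissible C f x c = ∀ {y} → C y → y ≢ x →
    (endA G y ≡ endA G x → f y ≢ c) × (endB G y ≡ endB G x → r y ⟨$⟩ʳ f y ≢ r x ⟨$⟩ʳ c)

  _[_≔_] : (Edge G → Fin 4) → Edge G → Fin 4 → Edge G → Fin 4
  f [ x ≔ c ] = updateAt f x (const c)

  extend : ∀ {C f x c} → ProperOn C f → Admissible C f x c → ProperOn (C ∪ ｛ x ｝) (f [ x ≔ c ])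
  extend {C} {f} {x} {c} proper admissible {y} {z} y∈ z∈ y≢z = go (y ≟ x) (z ≟ x)
    where
    old : ∀ {y} → (C ∪ ｛ x ｝) y → y ≢ x → C y
    old (inj₁ cy)  _   = cy
    old (inj₂ x≡y) y≢x = contradiction (sym x≡y) y≢x

    towards-x : ∀ {y} → C y → y ≢ x → Compatible (f [ x ≔ c ]) y x
    towards-x {y} cy y≢x rewrite updateAt-minimal y x {const c} f y≢x | updateAt-updates x {const c} f =
      admissible cy y≢x

    go : Dec (y ≡ x) → Dec (z ≡ x) → Compatible (f [ x ≔ c ]) y z
    go (yes refl) (yes refl) = contradiction refl y≢z
    go (yes refl) (no z≢x)   = Compatible-sym (towards-x (old z∈ z≢x) z≢x)
    go (no y≢x)   (yes refl) = towards-x (old y∈ y≢x) y≢x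
    go (no y≢x)   (no z≢x)
      rewrite updateAt-minimal y x {const c} f y≢x | updateAt-minimal z x {const c} f z≢x =
      proper (old y∈ y≢x) (old z∈ z≢x) y≢z

  -- At a common B-end, y forbids x exactly the colour r x⁻¹ (r y (f y)).
  Covers : Pred (Edge G) 0ℓ → (Edge G → Fin 4) → Edge G → List (Fin 4) → Set
  Covers C f x cs = ∀ {y} → C y → y ≢ x →
    (endA G y ≡ endA G x → f y ∈ cs) × (endB G y ≡ endB G x → r x ⟨$⟩ˡ (r y ⟨$⟩ʳ f y) ∈ cs)

  admissible-colour : ∀ {C f x} cs → length cs ≤ 3 → Covers C f x cs → ∃ (Admissible C f x)
  admissible-colour {C} {f} {x} cs len covers = map₂ admissible (length<⇒∃∉ cs (s≤s len))
    where
    admissible : ∀ {c} → c ∉ cs → Admissible C f x c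
    admissible c∉ cy y≢x =
      (λ sameA fy≡c → c∉ (subst (_∈ cs) fy≡c (proj₁ (covers cy y≢x) sameA))) ,
      (λ sameB ry≡rx → c∉ (subst (_∈ cs) (⟨$⟩ʳ⇒⟨$⟩ˡ (r x) (sym ry≡rx)) (proj₂ (covers cy y≢x) sameB)))

  module _ {P Q : Pred (Edge G) 0ℓ} (P? : Decidable P) (Q? : Decidable Q) (f : Edge G → Fin 4) (x : Edge G) where

    private
      P-edges Q-edges : List (Edge G)
      P-edges = filter P? (allFin _)
      Q-edges = filter Q? (allFin _)

    coloursOf : List (Fin 4)
    coloursOf = map f P-edges ++ map (λ y → r x ⟨$⟩ˡ (r y ⟨$⟩ʳ f y)) Q-edges

    length-coloursOf : length coloursOf ≡ count P? + count Q?
    length-coloursOf = trans (length-++ (map f P-edges)) (cong₂ _+_ (length-map f P-edges) (length-map _ Q-edges))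

    ∈-coloursOfᴬ : ∀ {y} → P y → f y ∈ coloursOf
    ∈-coloursOfᴬ py = ∈-++⁺ˡ (∈-map⁺ f (∈-filter⁺ P? (∈-allFin _) py))

    ∈-coloursOfᴮ : ∀ {y} → Q y → r x ⟨$⟩ˡ (r y ⟨$⟩ʳ f y) ∈ coloursOf
    ∈-coloursOfᴮ qy = ∈-++⁺ʳ (map f P-edges) (∈-map⁺ _ (∈-filter⁺ Q? (∈-allFin _) qy))

module Greedy (G : BipartiteMultigraph) (r : Edge G → Distortion)
              {act : Pred (Edge G) 0ℓ} (act? : Decidable act) (subcubic : Degrees.Subcubic G act?) where

  open Degrees G act?
  open Colouring G r

  count-nbrA<3 : ∀ {x} → act x → count (nbrA? x) < 3
  count-nbrA<3 ax = <-≤-trans (count-nbrA< ax) (proj₁ subcubic _)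

  count-nbrB<3 : ∀ {x} → act x → count (nbrB? x) < 3
  count-nbrB<3 ax = <-≤-trans (count-nbrB< ax) (proj₂ subcubic _)

  extend-avoiding : ∀ {C f} e x → ProperOn C f → C ⊆ act - e →
                    count (nbrA? x -? e) + count (nbrB? x -? e) ≤ 3 →
                    ∃ λ c → ProperOn (C ∪ ｛ x ｝) (f [ x ≔ c ])
  extend-avoiding {C} {f} e x proper C⊆ bound =
    map₂ (extend proper) (admissible-colour colours (≤-trans (≤-reflexive (length-coloursOf P? Q? f x)) bound) covers)
    where
    P? : Decidable (NbrA x - e)
    P? = nbrA? x -? e
    Q? : Decidable (NbrB x - e)
    Q? = nbrB? x -? e
    colours : List (Fin 4)
    colours = coloursOf P? Q? f x
    covers : Covers C f x colours
    covers cy y≢x =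
      let ay , e≢y = C⊆ cy
      in (λ sameA → ∈-coloursOfᴬ P? Q? f x (((ay , sameA) , y≢x ∘ sym) , e≢y)) ,
         (λ sameB → ∈-coloursOfᴮ P? Q? f x (((ay , sameB) , y≢x ∘ sym) , e≢y))

  touching-bound : ∀ {e x} → act e → (act - e) x → Touches e x →
                   count (nbrA? x -? e) + count (nbrB? x -? e) ≤ 3
  touching-bound {x = x} ae (ax , e≢x) (inj₁ sameA) =
    sum-bound (count-remove-member (nbrA? x) ((ae , sym sameA) , e≢x ∘ sym) (count-nbrA<3 ax))
              (count-remove-any (nbrB? x) (count-nbrB<3 ax)) ≤-refl
  touching-bound {x = x} ae (ax , e≢x) (inj₂ sameB) =
    sum-bound (count-remove-any (nbrA? x) (count-nbrA<3 ax))
              (count-remove-member (nbrB? x) ((ae , sym sameB) , e≢x ∘ sym) (count-nbrB<3 ax)) ≤-refl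

  -- Greedy colouring succeeds because every t still has the uncoloured edge e as a neighbour.
  sweep : ∀ {C f e} → act e → (ts : List (Edge G)) → All (λ t → (act - e) t × Touches e t) ts →
          ProperOn C f → C ⊆ act - e →
          ∃ λ f′ → ProperOn (C ∪ (_∈ ts)) f′ × (∀ {y} → y ∉ ts → f′ y ≡ f y)
  sweep {f = f} ae [] [] proper C⊆ = f , ProperOn-mono (λ { (inj₁ cy) → cy }) proper , λ _ → refl
  sweep {C} {f} {e} ae (t ∷ ts) ((t∈ , touches) ∷ all) proper C⊆ =
    let c , proper′ = extend-avoiding e t proper C⊆ (touching-bound ae t∈ touches)
        f′ , proper″ , unchanged = sweep ae ts all proper′ C′⊆
    in f′ , ProperOn-mono regroup proper″ ,
       λ y∉ → trans (unchanged (y∉ ∘ there)) (updateAt-minimal _ t f (y∉ ∘ here))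
    where
    C′⊆ : C ∪ ｛ t ｝ ⊆ act - e
    C′⊆ (inj₁ cy)   = C⊆ cy
    C′⊆ (inj₂ refl) = t∈
    regroup : C ∪ (_∈ t ∷ ts) ⊆ (C ∪ ｛ t ｝) ∪ (_∈ ts)
    regroup (inj₁ cy)           = inj₁ (inj₁ cy)
    regroup (inj₂ (here refl))  = inj₁ (inj₂ refl)
    regroup (inj₂ (there y∈ts)) = inj₂ y∈ts

-- Induction on the number of edges still to be coloured, given as a decidable subset act of
-- the edges: deleting edges changes act but keeps the multigraph fixed.
Colourable : ℕ → Set₁
Colourable k = ∀ G (r : Edge G → Distortion) {act : Pred (Edge G) 0ℓ} (act? : Decidable act) →
               count act? ≤ k → Degrees.Subcubic G act? → ∃ (Colouring.ProperOn G r act)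

module Step {k} (colour-smaller : Colourable k) (G : BipartiteMultigraph) (r : Edge G → Distortion)
            {act : Pred (Edge G) 0ℓ} (act? : Decidable act) (size : count act? ≤ suc k)
            (subcubic : Degrees.Subcubic G act?) {e : Edge G} (ae : act e) where

  open Degrees G act?
  open Colouring G r
  open Greedy G r act? subcubic

  a : Fin (nA G)
  a = endA G e

  b : Fin (nB G)
  b = endB G e

  restrict : ∀ {act′} (act′? : Decidable act′) → act′ ⊆ act → ¬ act′ e → ∃ (ProperOn act′)
  restrict act′? act′⊆act e∉act′ =
    colour-smaller G r act′? (s≤s⁻¹ (<-≤-trans (count-< act′? act? act′⊆act ae e∉act′) size))
      ( (λ v → ≤-trans (count-mono (Degrees.starA? G act′? v) (starA? v) (λ (y∈ , at) → act′⊆act y∈ , at)) (proj₁ subcubic v))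
      , (λ v → ≤-trans (count-mono (Degrees.starB? G act′? v) (starB? v) (λ (y∈ , at) → act′⊆act y∈ , at)) (proj₂ subcubic v)))

  deficient : degreeA a + degreeB b ≤ 5 → ∃ (ProperOn act)
  deficient small =
    let f , proper = restrict (act? -? e) proj₁ (λ (_ , e≢e) → e≢e refl)
        c , proper′ = extend-avoiding e e proper (λ y∈ → y∈) bound
    in f [ e ≔ c ] , ProperOn-mono split proper′
    where
    bound : count (nbrA? e -? e) + count (nbrB? e -? e) ≤ 3
    bound = sum-bound (≤-<-trans (count-mono (nbrA? e -? e) (nbrA? e) proj₁) (count-nbrA< ae))
                      (≤-<-trans (count-mono (nbrB? e -? e) (nbrB? e) proj₁) (count-nbrB< ae)) small
    split : act ⊆ (act - e) ∪ ｛ e ｝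
    split {y} ay with e ≟ y
    ... | yes e≡y = inj₂ e≡y
    ... | no e≢y  = inj₁ (ay , e≢y)

  module Triple (A⊆B : StarA a ⊆ StarB b) (B⊆A : StarB b ⊆ StarA a) where

    Rest : Pred (Edge G) 0ℓ
    Rest = act ∩ ∁ (λ y → endA G y ≡ a)

    rest-isolated : ∀ {y} → Rest y → endA G y ≢ a × endB G y ≢ b
    rest-isolated (ay , off-a) = off-a , λ at-b → off-a (proj₂ (B⊆A (ay , at-b)))

    admissible-beside-rest : ∀ {C f x c} → StarA a x →
                             (∀ {y} → C y → y ≢ x → Rest y ⊎ Separated (r y) (f y) (r x) c) →
                             Admissible C f x c
    admissible-beside-rest x∈ classify cy y≢x with classify cy y≢x
    ... | inj₁ y∈rest = (λ sameA → contradiction (trans sameA (proj₂ x∈)) (proj₁ (rest-isolated y∈rest))) ,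
                        (λ sameB → contradiction (trans sameB (proj₂ (A⊆B x∈))) (proj₂ (rest-isolated y∈rest)))
    ... | inj₂ (c≢ , image≢) = (λ _ → c≢) , (λ _ → image≢)

    colour-triple : ∀ {x₁ x₂ x₃ c₁ c₂ c₃ f₀} → StarA a x₁ → StarA a x₂ → StarA a x₃ → x₁ ≢ x₂ →
                    SeparatedTriple (r x₁) (r x₂) (r x₃) c₁ c₂ c₃ → ProperOn Rest f₀ →
                    ProperOn (((Rest ∪ ｛ x₁ ｝) ∪ ｛ x₂ ｝) ∪ ｛ x₃ ｝) (((f₀ [ x₁ ≔ c₁ ]) [ x₂ ≔ c₂ ]) [ x₃ ≔ c₃ ])
    colour-triple {x₁} {x₂} {x₃} {c₁} {c₂} {c₃} {f₀} x₁∈ x₂∈ x₃∈ x₁≢x₂ (sep₁₂ , sep₁₃ , sep₂₃) proper₀ =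
      extend {f = f₂} {c = c₃} proper₂ (admissible-beside-rest {C = S₂} {f = f₂} {c = c₃} x₃∈ λ
        { (inj₁ (inj₁ y∈)) _ → inj₁ y∈
        ; (inj₁ (inj₂ refl)) _ → inj₂ (subst (λ c → Separated (r x₁) c (r x₃) c₃) (sym f₂-x₁) sep₁₃)
        ; (inj₂ refl) _ → inj₂ (subst (λ c → Separated (r x₂) c (r x₃) c₃) (sym (updateAt-updates x₂ f₁)) sep₂₃) })
      where
      f₁ f₂ : Edge G → Fin 4
      f₁ = f₀ [ x₁ ≔ c₁ ]
      f₂ = f₁ [ x₂ ≔ c₂ ]
      S₁ S₂ : Pred (Edge G) 0ℓ
      S₁ = Rest ∪ ｛ x₁ ｝
      S₂ = S₁ ∪ ｛ x₂ ｝
      f₂-x₁ : f₂ x₁ ≡ c₁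
      f₂-x₁ = trans (updateAt-minimal x₁ x₂ f₁ x₁≢x₂) (updateAt-updates x₁ f₀)
      proper₁ : ProperOn S₁ f₁
      proper₁ = extend {f = f₀} {c = c₁} proper₀ (admissible-beside-rest {f = f₀} {c = c₁} x₁∈ λ y∈ _ → inj₁ y∈)
      proper₂ : ProperOn S₂ f₂
      proper₂ = extend {f = f₁} {c = c₂} proper₁ (admissible-beside-rest {C = S₁} {f = f₁} {c = c₂} x₂∈ λ
        { (inj₁ y∈) _ → inj₁ y∈
        ; (inj₂ refl) _ → inj₂ (subst (λ c → Separated (r x₁) c (r x₂) c₂) (sym (updateAt-updates x₁ f₀)) sep₁₂) })

    triple : ∀ xs → (∀ {y} → StarA a y → y ∈ xs) → All (StarA a) xs → Unique xs → length xs ≡ 3 →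
             ∃ (ProperOn act)
    triple (x₁ ∷ x₂ ∷ x₃ ∷ []) every (x₁∈ ∷ x₂∈ ∷ x₃∈ ∷ []) ((x₁≢x₂ ∷ _) ∷ _) refl =
      let f₀ , proper₀ = restrict (act? ∩? ∁? (λ y → endA G y ≟ a)) proj₁ (λ (_ , off-a) → off-a refl)
          c₁ , c₂ , c₃ , separated = separate-three (r x₁) (r x₂) (r x₃)
      in ((f₀ [ x₁ ≔ c₁ ]) [ x₂ ≔ c₂ ]) [ x₃ ≔ c₃ ] ,
         ProperOn-mono split (colour-triple x₁∈ x₂∈ x₃∈ x₁≢x₂ separated proper₀)
      where
      split : act ⊆ ((Rest ∪ ｛ x₁ ｝) ∪ ｛ x₂ ｝) ∪ ｛ x₃ ｝
      split {y} ay with endA G y ≟ a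
      ... | no off-a = inj₁ (inj₁ (inj₁ (ay , off-a)))
      ... | yes at-a with every (ay , at-a)
      ...   | here y≡x₁                 = inj₁ (inj₁ (inj₂ (sym y≡x₁)))
      ...   | there (here y≡x₂)         = inj₁ (inj₂ (sym y≡x₂))
      ...   | there (there (here y≡x₃)) = inj₂ (sym y≡x₃)
    triple []                  _ _ _ ()
    triple (_ ∷ [])            _ _ _ ()
    triple (_ ∷ _ ∷ [])        _ _ _ ()
    triple (_ ∷ _ ∷ _ ∷ _ ∷ _) _ _ _ ()

    colouring : degreeA a ≡ 3 → ∃ (ProperOn act)
    colouring = triple (filter (starA? a) (allFin _)) (∈-filter⁺ (starA? a) (∈-allFin _))
                       (all-filter (starA? a) (allFin _)) (filter⁺ (starA? a) (allFin⁺ _))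
  module Merge {u w : Edge G} (au : act u) (u-at-a : endA G u ≡ a) (u-off-b : endB G u ≢ b)
                              (aw : act w) (w-at-b : endB G w ≡ b) (w-off-a : endA G w ≢ a) where

    e≢u : e ≢ u
    e≢u e≡u = u-off-b (cong (endB G) (sym e≡u))

    e≢w : e ≢ w
    e≢w e≡w = w-off-a (cong (endA G) (sym e≡w))

    u≢w : u ≢ w
    u≢w u≡w = u-off-b (trans (cong (endB G) u≡w) w-at-b)

    Far : Pred (Edge G) 0ℓ
    Far = act ∩ ∁ (Touches e)

    far-off-a : ∀ {y} → Far y → endA G y ≢ a
    far-off-a (_ , ¬touch) = ¬touch ∘ inj₁

    far-off-b : ∀ {y} → Far y → endB G y ≢ b
    far-off-b (_ , ¬touch) = ¬touch ∘ inj₂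

    far-≢u : ∀ {y} → Far y → y ≢ u
    far-≢u far refl = far-off-a far u-at-a

    far-≢w : ∀ {y} → Far y → y ≢ w
    far-≢w far refl = far-off-b far w-at-b

    G* : BipartiteMultigraph
    G* = record G { endA = updateAt (endA G) u (const (endA G w)) }

    r* : Edge G → Distortion
    r* = updateAt r u (const (r w ∘ₚ flip (r e) ∘ₚ r u))

    Act* : Pred (Edge G) 0ℓ
    Act* = ｛ u ｝ ∪ Far

    act*? : Decidable Act*
    act*? = (u ≟_) ∪? (act? ∩? ∁? (touches? e))

    Act*⊆act : Act* ⊆ act
    Act*⊆act (inj₁ refl)     = au
    Act*⊆act (inj₂ (ay , _)) = ay

    e∉Act* : ¬ Act* e
    e∉Act* (inj₁ u≡e)          = e≢u (sym u≡e)
    e∉Act* (inj₂ (_ , ¬touch)) = ¬touch (inj₁ refl)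

    endA-far : ∀ {y} → Far y → endA G y ≡ endA G* y
    endA-far far = sym (updateAt-minimal _ u (endA G) (far-≢u far))

    endA-w : endA G w ≡ endA G* u
    endA-w = sym (updateAt-updates u (endA G))

    subcubic* : Degrees.Subcubic G* act*?
    subcubic* = degreeA* , degreeB*
      where
      open Degrees G* act*? using () renaming (StarA to StarA*; starA? to starA*?; starB? to starB*?)

      degreeB* : ∀ v → count (starB*? v) ≤ 3
      degreeB* v = ≤-trans (count-mono (starB*? v) (starB? v) (λ (y∈ , at) → Act*⊆act y∈ , at)) (proj₂ subcubic v)

      degreeA* : ∀ v → count (starA*? v) ≤ 3
      degreeA* v with v ≟ endA G w
      -- at the A-end of w, the moved edge u takes the place of w
      ... | yes refl =
        ≤-trans (count-mono (starA*? v) ((u ≟_) ∪? (starA? v -? w)) into)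
          (≤-trans (count-∪ (u ≟_) (starA? v -? w))
            (+-mono-≤ (count-｛｝ u) (s≤s⁻¹ (<-≤-trans (count-remove (starA? v) (aw , refl)) (proj₁ subcubic v)))))
        where
        into : StarA* v ⊆ ｛ u ｝ ∪ (StarA v - w)
        into (inj₁ u≡y , _) = inj₁ u≡y
        into (inj₂ far , at) = inj₂ ((proj₁ far , trans (endA-far far) at) , far-≢w far ∘ sym)
      ... | no v≢ = ≤-trans (count-mono (starA*? v) (starA? v) into) (proj₁ subcubic v)
        where
        into : StarA* v ⊆ StarA v
        into (inj₁ refl , at) = contradiction (trans endA-w at) (v≢ ∘ sym)
        into (inj₂ far , at) = proj₁ far , trans (endA-far far) at

    open Colouring G* r* using () renaming (ProperOn to ProperOn*)

    coloured* : ∃ (ProperOn* Act*)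
    coloured* = colour-smaller G* r* act*? (s≤s⁻¹ (<-≤-trans (count-< act*? act? Act*⊆act ae e∉Act*) size)) subcubic*

    f* : Edge G → Fin 4
    f* = proj₁ coloured*

    proper* : ProperOn* Act* f*
    proper* = proj₂ coloured*

    -- w takes over the colour of the merged edge u, and u gets the colour that w then forbids
    -- for e, so that u and w forbid the same colour of e.
    f₀ : Edge G → Fin 4
    f₀ = (f* [ w ≔ f* u ]) [ u ≔ r e ⟨$⟩ˡ (r w ⟨$⟩ʳ f* u) ]

    colour-u : f₀ u ≡ r e ⟨$⟩ˡ (r w ⟨$⟩ʳ f* u)
    colour-u = updateAt-updates u (f* [ w ≔ f* u ])

    colour-w : f₀ w ≡ f* u
    colour-w = trans (updateAt-minimal w u (f* [ w ≔ f* u ]) (u≢w ∘ sym)) (updateAt-updates w f*)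

    colour-far : ∀ {y} → Far y → f₀ y ≡ f* y
    colour-far far = trans (updateAt-minimal _ u (f* [ w ≔ f* u ]) (far-≢u far)) (updateAt-minimal _ w f* (far-≢w far))

    image-u : r u ⟨$⟩ʳ f₀ u ≡ r* u ⟨$⟩ʳ f* u
    image-u = trans (cong (r u ⟨$⟩ʳ_) colour-u) (cong (_⟨$⟩ʳ f* u) (sym (updateAt-updates u r)))

    image-far : ∀ {y} → Far y → r y ⟨$⟩ʳ f₀ y ≡ r* y ⟨$⟩ʳ f* y
    image-far far = cong₂ _⟨$⟩ʳ_ (sym (updateAt-minimal _ u r (far-≢u far))) (colour-far far)

    compatible-u-w : Compatible f₀ u w
    compatible-u-w = (λ sameA → contradiction (trans (sym sameA) u-at-a) w-off-a) ,
                     (λ sameB → contradiction (trans sameB w-at-b) u-off-b)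

    compatible-u-far : ∀ {z} → Far z → Compatible f₀ u z
    compatible-u-far far =
      (λ sameA → contradiction (trans (sym sameA) u-at-a) (far-off-a far)) ,
      (λ sameB → subst₂ _≢_ (sym image-u) (sym (image-far far))
                   (proj₂ (proper* (inj₁ refl) (inj₂ far) (far-≢u far ∘ sym)) sameB))

    compatible-w-far : ∀ {z} → Far z → Compatible f₀ w z
    compatible-w-far far =
      (λ sameA → subst₂ _≢_ (sym colour-w) (sym (colour-far far))
                   (proj₁ (proper* (inj₁ refl) (inj₂ far) (far-≢u far ∘ sym))
                     (trans (sym endA-w) (trans sameA (endA-far far))))) ,
      (λ sameB → contradiction (trans (sym sameB) w-at-b) (far-off-b far))

    compatible-far-far : ∀ {y z} → Far y → Far z → y ≢ z → Compatible f₀ y z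
    compatible-far-far far₁ far₂ y≢z =
      let sameA⇒≢ , sameB⇒≢ = proper* (inj₂ far₁) (inj₂ far₂) y≢z
      in (λ sameA → subst₂ _≢_ (sym (colour-far far₁)) (sym (colour-far far₂))
                      (sameA⇒≢ (trans (sym (endA-far far₁)) (trans sameA (endA-far far₂))))) ,
         (λ sameB → subst₂ _≢_ (sym (image-far far₁)) (sym (image-far far₂)) (sameB⇒≢ sameB))

    C₀ : Pred (Edge G) 0ℓ
    C₀ = Act* ∪ ｛ w ｝

    proper₀ : ProperOn C₀ f₀
    proper₀ (inj₁ (inj₁ refl)) (inj₁ (inj₁ refl)) u≢u = contradiction refl u≢u
    proper₀ (inj₁ (inj₁ refl)) (inj₁ (inj₂ far))  _   = compatible-u-far far
    proper₀ (inj₁ (inj₁ refl)) (inj₂ refl)        _   = compatible-u-w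
    proper₀ (inj₁ (inj₂ far))  (inj₁ (inj₁ refl)) _   = Compatible-sym {f = f₀} (compatible-u-far far)
    proper₀ (inj₁ (inj₂ far₁)) (inj₁ (inj₂ far₂)) y≢z = compatible-far-far far₁ far₂ y≢z
    proper₀ (inj₁ (inj₂ far))  (inj₂ refl)        _   = Compatible-sym {f = f₀} (compatible-w-far far)
    proper₀ (inj₂ refl)        (inj₁ (inj₁ refl)) _   = Compatible-sym {f = f₀} compatible-u-w
    proper₀ (inj₂ refl)        (inj₁ (inj₂ far))  _   = compatible-w-far far
    proper₀ (inj₂ refl)        (inj₂ refl)        w≢w = contradiction refl w≢w

    C₀⊆ : C₀ ⊆ act - e
    C₀⊆ (inj₁ (inj₁ refl))          = au , e≢u
    C₀⊆ (inj₁ (inj₂ (ay , ¬touch))) = ay , λ e≡y → ¬touch (subst (Touches e) e≡y (inj₁ refl))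
    C₀⊆ (inj₂ refl)                 = aw , e≢w

    Pending : Pred (Edge G) 0ℓ
    Pending = ((act - e) ∩ Touches e) - u - w

    pending? : Decidable Pending
    pending? = ((act? -? e) ∩? touches? e) -? u -? w

    pending : List (Edge G)
    pending = filter pending? (allFin _)

    pending⁻ : ∀ {y} → y ∈ pending → Pending y
    pending⁻ y∈ = proj₂ (∈-filter⁻ pending? {xs = allFin _} y∈)

    C₁ : Pred (Edge G) 0ℓ
    C₁ = C₀ ∪ (_∈ pending)

    C₁⊆ : C₁ ⊆ act - e
    C₁⊆ (inj₁ y∈) = C₀⊆ y∈
    C₁⊆ (inj₂ y∈) = proj₁ (proj₁ (proj₁ (pending⁻ y∈)))

    swept : ∃ λ f₁ → ProperOn C₁ f₁ × (∀ {y} → y ∉ pending → f₁ y ≡ f₀ y)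
    swept = sweep ae pending (All.map (λ (((t∈ , touch) , _) , _) → t∈ , touch) (all-filter pending? (allFin _)))
                  proper₀ C₀⊆

    f₁ : Edge G → Fin 4
    f₁ = proj₁ swept

    coincidence : f₁ u ≡ r e ⟨$⟩ˡ (r w ⟨$⟩ʳ f₁ w)
    coincidence =
      trans (unchanged u∉) (trans colour-u (cong (λ c → r e ⟨$⟩ˡ (r w ⟨$⟩ʳ c)) (sym (trans (unchanged w∉) colour-w))))
      where
      unchanged : ∀ {y} → y ∉ pending → f₁ y ≡ f₀ y
      unchanged = proj₂ (proj₂ swept)
      u∉ : u ∉ pending
      u∉ u∈ = proj₂ (proj₁ (pending⁻ u∈)) refl
      w∉ : w ∉ pending
      w∉ w∈ = proj₂ (pending⁻ w∈) refl

    clashA? : Decidable (NbrA e - e)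
    clashA? = nbrA? e -? e

    clashB? : Decidable (NbrB e - e - w)
    clashB? = nbrB? e -? e -? w

    covers : Covers C₁ f₁ e (coloursOf clashA? clashB? f₁ e)
    covers {y} y∈ y≢e = (λ sameA → ∈-coloursOfᴬ clashA? clashB? f₁ e (((ay , sameA) , y≢e ∘ sym) , e≢y)) , B-side
      where
      ay : act y
      ay = proj₁ (C₁⊆ y∈)
      e≢y : e ≢ y
      e≢y = proj₂ (C₁⊆ y∈)
      B-side : endB G y ≡ b → r e ⟨$⟩ˡ (r y ⟨$⟩ʳ f₁ y) ∈ coloursOf clashA? clashB? f₁ e
      B-side sameB with w ≟ y
      ... | yes refl = subst (_∈ coloursOf clashA? clashB? f₁ e) coincidence
                             (∈-coloursOfᴬ clashA? clashB? f₁ e (((au , u-at-a) , e≢u) , e≢u))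
      ... | no w≢y = ∈-coloursOfᴮ clashA? clashB? f₁ e ((((ay , sameB) , y≢e ∘ sym) , e≢y) , w≢y)

    bound : count clashA? + count clashB? ≤ 3
    bound = sum-bound (count-remove-any (nbrA? e) (count-nbrA<3 ae))
                      (count-remove-member (nbrB? e -? e) (((aw , w-at-b) , e≢w) , e≢w)
                        (count-remove-any (nbrB? e) (count-nbrB<3 ae))) ≤-refl

    colouring : ∃ (ProperOn act)
    colouring =
      let c , admissible = admissible-colour (coloursOf clashA? clashB? f₁ e)
                             (≤-trans (≤-reflexive (length-coloursOf clashA? clashB? f₁ e)) bound) covers
      in f₁ [ e ≔ c ] , ProperOn-mono split (extend {f = f₁} {c = c} (proj₁ (proj₂ swept)) admissible)
      where
      split : act ⊆ C₁ ∪ ｛ e ｝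
      split {y} ay with e ≟ y
      ... | yes e≡y = inj₂ e≡y
      ... | no e≢y with touches? e y
      ...   | no ¬touch = inj₁ (inj₁ (inj₁ (inj₂ (ay , ¬touch))))
      ...   | yes touch with u ≟ y
      ...     | yes u≡y = inj₁ (inj₁ (inj₁ (inj₁ u≡y)))
      ...     | no u≢y with w ≟ y
      ...       | yes w≡y = inj₁ (inj₁ (inj₂ w≡y))
      ...       | no w≢y = inj₁ (inj₂ (∈-filter⁺ pending? (∈-allFin y) ((((ay , e≢y) , touch) , u≢y) , w≢y)))

  colour-full : ¬ degreeA a + degreeB b ≤ 5 → ∃ (ProperOn act)
  colour-full big = by-cases (anyᶠ? (starA? a ∩? ∁? (λ y → endB G y ≟ b)))
                             (anyᶠ? (starB? b ∩? ∁? (λ y → endA G y ≟ a)))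
    where
    full : degreeA a ≡ 3 × degreeB b ≡ 3
    full = both≡3 (proj₁ subcubic a) (proj₂ subcubic b) big

    by-cases : Dec (∃ (StarA a ∩ ∁ (λ y → endB G y ≡ b))) → Dec (∃ (StarB b ∩ ∁ (λ y → endA G y ≡ a))) →
               ∃ (ProperOn act)
    by-cases (yes (u , (au , u-at-a) , u-off-b)) (yes (w , (aw , w-at-b) , w-off-a)) =
      Merge.colouring au u-at-a u-off-b aw w-at-b w-off-a
    by-cases (no no-u) _ = Triple.colouring A⊆B (count-⊇ (starA? a) (starB? b) A⊆B B≤A) (proj₁ full)
      where
      A⊆B : StarA a ⊆ StarB b
      A⊆B {y} (ay , at-a) = ay , decidable-stable (endB G y ≟ b) (λ off-b → no-u (y , (ay , at-a) , off-b))
      B≤A : degreeB b ≤ degreeA a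
      B≤A = ≤-trans (proj₂ subcubic b) (≤-reflexive (sym (proj₁ full)))
    by-cases _ (no no-w) = Triple.colouring (count-⊇ (starB? b) (starA? a) B⊆A A≤B) B⊆A (proj₁ full)
      where
      B⊆A : StarB b ⊆ StarA a
      B⊆A {y} (ay , at-b) = ay , decidable-stable (endA G y ≟ a) (λ off-a → no-w (y , (ay , at-b) , off-a))
      A≤B : degreeA a ≤ degreeB b
      A≤B = ≤-trans (proj₁ subcubic a) (≤-reflexive (sym (proj₂ full)))

  colour-around : ∃ (ProperOn act)
  colour-around with degreeA a + degreeB b ≤? 5
  ... | yes small = deficient small
  ... | no big    = colour-full big

colour : ∀ k → Colourable k
colour zero G r act? size _ = (λ _ → zero) , λ ax → contradiction (<-≤-trans (count-remove act? ax) size) n≮0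
colour (suc k) G r act? size subcubic with anyᶠ? act?
... | no none      = (λ _ → zero) , λ ax → contradiction (_ , ax) none
... | yes (e , ae) = Step.colour-around (colour k) G r act? size subcubic ae

mainTheorem1 : (G : BipartiteMultigraph) → MaxDegreeAtMost 3 G →
    (r : Edge G → Distortion) →
    Σ (Edge G → Fin 4) (λ f → IsProperDistortionColouring G r f)
mainTheorem1 G (degA≤3 , degB≤3) r =
  let f , proper = colour _ G r U? ≤-refl (subcubicA , subcubicB)
  in f , (λ x y x≢y → proj₁ (proper tt tt x≢y)) , (λ x y x≢y → proj₂ (proper tt tt x≢y))
  where
  open Degrees G U? using (degreeA; degreeB; starA?; starB?)
  subcubicA : ∀ a → degreeA a ≤ 3
  subcubicA a = ≤-trans (count-mono (starA? a) (λ y → endA G y ≟ a) proj₂) (degA≤3 a)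
  subcubicB : ∀ b → degreeB b ≤ 3
  subcubicB b = ≤-trans (count-mono (starB? b) (λ y → endB G y ≟ b) proj₂) (degB≤3 b)
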